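{- For each positive integer $n$, define a map $V$ on $C(n)$ as follows. Given $c\in C(n)$, append a final part $0$ if $c$ has odd length, so that $c=(c_1,\ldots,c_{2u})$. Replace each pair $(c_{2i-1},c_{2i})$, $1\le i\le u$, by \[ \begin{cases} (1^{c_{2i-1}-c_{2i}},\,2c_{2i}) & \text{if } c_{2i}-c_{2i-1}<1,\\ (1^{c_{2i-1}+c_{2i}-2k-1},\,2k+1) & \text{if } 2k-1 \le c_{2i}-c_{2i-1} < 2k+1 \text{ for an integer } k\ge 1,\end{cases}\] where a resulting part $0$ (when $c_{2i}=0$) is omitted, and let $V(c)$ be the concatenation of these blocks in order. Then $V$ is a permutation (bijection) of $C(n)$.
   Context: $C(n)$ is the set of compositions of $n$, i.e., finite sequences of positive integers summing to $n$. $1^m$ denotes $m$ consecutive parts equal to $1$ (nothing if $m=0$). -}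

module Defs where

open import Data.Nat using (ℕ; zero; suc; _+_; _*_; _∸_; _<_; _≤ᵇ_; _/_)
open import Data.Bool using (if_then_else_)
open import Data.List using (List; []; _∷_; _++_; replicate)
open import Data.Nat.ListAction using (sum)
open import Data.List.Relation.Unary.All using (All)
open import Relation.Binary.PropositionalEquality using (_≡_)

IsComposition : ℕ → List ℕ → Set
IsComposition n c = All (λ x → 0 < x) c × sum c ≡ n
  where open import Data.Product using (_×_)

ones : ℕ → List ℕ
ones m = replicate m 1

-- Case b - a < 1 (i.e. b ≤ a): (1^{a-b}, 2b), the part 2b omitted when b = 0.
-- Case 2k-1 ≤ b - a < 2k+1, k ≥ 1: (1^{a+b-2k-1}, 2k+1);
--   here k = ⌊(b - a + 1) / 2⌋.
pairBlock : ℕ → ℕ → List ℕ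
pairBlock a zero = ones a
pairBlock a (suc b') =
  if suc b' ≤ᵇ a
  then ones (a ∸ suc b') ++ (2 * suc b' ∷ [])
  else ones (a + suc b' ∸ (2 * k + 1)) ++ ((2 * k + 1) ∷ [])
  where
    k : ℕ
    k = (suc b' ∸ a + 1) / 2

V : List ℕ → List ℕ
V [] = []
V (a ∷ []) = pairBlock a 0
V (a ∷ b ∷ c) = pairBlock a b ++ V c

-- V acts pair by pair, and a pair (a , b) of positive parts becomes a block 1^m p
-- with a last part p ≥ 2 and m + p = a + b.  Conversely each such block comes from
-- exactly one pair: an even p = 2b from the descent (m + b , b), an odd p from the
-- ascent (⌊m/2⌋ + 1 , ⌈m/2⌉ + p − 1).  Since the parts ≥ 2 of V c delimit its blocks,
-- and an odd last part a becomes 1^a, decoding V c block by block recovers c; encoding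
-- a composition block by block produces a preimage.
module Submission where

open import Data.Bool using (true; false)
open import Data.Bool.Properties using (T-≡)
open import Data.Empty using (⊥-elim)
open import Data.List using (List; []; _∷_; _++_)
open import Data.List.Properties using (++-assoc; ++-identityʳ)
open import Data.List.Relation.Unary.All using (All; []; _∷_)
open import Data.List.Relation.Unary.All.Properties using (++⁺; replicate⁺)
open import Data.Nat
open import Data.Nat.DivMod using (m/n≡1+[m∸n]/n)
open import Data.Nat.ListAction using (sum)
open import Data.Nat.ListAction.Properties using (sum-++)
open import Data.Nat.Properties
open import Data.Nat.Tactic.RingSolver using (solve-∀)
open import Data.Parity.Base using (Parity; 0ℙ; 1ℙ)
open import Data.Product using (Σ; ∃₂; _×_; _,_)
open import Function.Bundles using (Equivalence)
open import Relation.Binary.PropositionalEquality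
open import Relation.Nullary using (yes; no)
open import Relation.Nullary.Reflects using (ofʸ)

open import Defs

open ≡-Reasoning

⌊n/2⌋≡n/2 : ∀ n → ⌊ n /2⌋ ≡ n / 2
⌊n/2⌋≡n/2 zero          = refl
⌊n/2⌋≡n/2 (suc zero)    = refl
⌊n/2⌋≡n/2 (suc (suc n)) =
  trans (cong suc (⌊n/2⌋≡n/2 n)) (sym (m/n≡1+[m∸n]/n {suc (suc n)} (s≤s (s≤s z≤n))))

⌊r+[n+n]/2⌋≡n : ∀ {r} n → r ≤ 1 → ⌊ r + (n + n) /2⌋ ≡ n
⌊r+[n+n]/2⌋≡n n z≤n       = sym (n≡⌊n+n/2⌋ n)
⌊r+[n+n]/2⌋≡n n (s≤s z≤n) = sym (n≡⌈n+n/2⌉ n)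

⌈r+[n+n]/2⌉≡r+n : ∀ {r} n → r ≤ 1 → ⌈ r + (n + n) /2⌉ ≡ r + n
⌈r+[n+n]/2⌉≡r+n n z≤n       = sym (n≡⌈n+n/2⌉ n)
⌈r+[n+n]/2⌉≡r+n n (s≤s z≤n) = cong suc (sym (n≡⌊n+n/2⌋ n))

parity[n+n]≡0ℙ : ∀ n → parity (n + n) ≡ 0ℙ
parity[n+n]≡0ℙ zero    = refl
parity[n+n]≡0ℙ (suc n) rewrite +-suc n n = parity[n+n]≡0ℙ n

parity[1+n+n]≡1ℙ : ∀ n → parity (suc (n + n)) ≡ 1ℙ
parity[1+n+n]≡1ℙ zero    = refl
parity[1+n+n]≡1ℙ (suc n) rewrite +-suc n n = parity[1+n+n]≡1ℙ n

data ParityView : ℕ → Set where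
  even : ∀ j → ParityView (j + j)
  odd  : ∀ j → ParityView (suc (j + j))

parityView : ∀ n → ParityView n
parityView zero          = even 0
parityView (suc zero)    = odd 0
parityView (suc (suc n)) with parityView n
... | even j = subst ParityView (cong suc (+-suc j j)) (even (suc j))
... | odd j  = subst ParityView (cong (λ x → suc (suc x)) (+-suc j j)) (odd (suc j))

Positive : List ℕ → Set
Positive = All (0 <_)

ones-positive : ∀ m → Positive (ones m)
ones-positive m = replicate⁺ m (s≤s z≤n)

sum-ones : ∀ m → sum (ones m) ≡ m
sum-ones zero    = refl
sum-ones (suc m) = cong suc (sum-ones m)

ones-suc : ∀ m d → ones (suc m) ++ d ≡ ones m ++ 1 ∷ d
ones-suc zero    d = refl
ones-suc (suc m) d = cong (1 ∷_) (ones-suc m d)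

block : ℕ → ℕ → List ℕ
block m p = ones m ++ p ∷ []

block-positive : ∀ m {p} → 0 < p → Positive (block m p)
block-positive m p>0 = ++⁺ (ones-positive m) (p>0 ∷ [])

sum-block : ∀ m p → sum (block m p) ≡ m + p
sum-block m p = trans (sum-++ (ones m) (p ∷ [])) (cong₂ _+_ (sum-ones m) (+-identityʳ p))

pairBlock-≥ : ∀ a b → suc b ≤ a → pairBlock a (suc b) ≡ block (a ∸ suc b) (2 * suc b)
pairBlock-≥ a b b<a rewrite Equivalence.to T-≡ (≤⇒≤ᵇ b<a) = refl

pairBlock-< : ∀ a b → a < suc b →
  pairBlock a (suc b) ≡ block (a + suc b ∸ (2 * ⌈ suc b ∸ a /2⌉ + 1)) (2 * ⌈ suc b ∸ a /2⌉ + 1)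
pairBlock-< a b (s≤s a≤b) with b <ᵇ a | <ᵇ-reflects-< b a
... | true  | ofʸ b<a = ⊥-elim (<⇒≱ b<a a≤b)
... | false | _ rewrite sym (⌊n/2⌋≡n/2 (suc b ∸ a + 1)) | +-comm (suc b ∸ a) 1 = refl

pairBlock-positive : ∀ a b → Positive (pairBlock a b)
pairBlock-positive a zero = ones-positive a
pairBlock-positive a (suc b) with suc b ≤? a
... | yes b<a = subst Positive (sym (pairBlock-≥ a b b<a)) (block-positive _ (s≤s z≤n))
... | no  b≮a = subst Positive (sym (pairBlock-< a b (≰⇒> b≮a))) (block-positive _ (m≤n+m 1 _))

-- Encodes a b m q : V turns the pair (a , b) into the block 1^m (q + 2).  A descent
-- has b ≤ a; an ascent has b − a = r + 2k + 1, and then m = r + 2i with a = i + 1.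
data Encodes : ℕ → ℕ → ℕ → ℕ → Set where
  descent : ∀ m b → Encodes (m + suc b) (suc b) m (b + b)
  ascent  : ∀ i r k → r ≤ 1 →
    Encodes (suc i) (suc i + (r + suc (k + k))) (r + (i + i)) (suc (k + k))

encodes-pairBlock : ∀ {a b m q} → Encodes a b m q → pairBlock a b ≡ block m (suc (suc q))
encodes-pairBlock (descent m b) = begin
  pairBlock (m + suc b) (suc b)          ≡⟨ pairBlock-≥ (m + suc b) b (m≤n+m (suc b) m) ⟩
  block (m + suc b ∸ suc b) (2 * suc b)  ≡⟨ cong₂ block (m+n∸n≡m m (suc b)) (double b) ⟩
  block m (suc (suc (b + b)))            ∎
  where
  double : ∀ b → 2 * suc b ≡ suc (suc (b + b))
  double = solve-∀
encodes-pairBlock (ascent i r k r≤1) = begin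
  pairBlock (suc i) (suc (i + g))
    ≡⟨ pairBlock-< (suc i) (i + g) (s≤s (m<m+n i g>0)) ⟩
  block (suc i + suc (i + g) ∸ (2 * ⌈ i + g ∸ i /2⌉ + 1)) (2 * ⌈ i + g ∸ i /2⌉ + 1)
    ≡⟨ cong (λ x → block (suc i + suc (i + g) ∸ (2 * x + 1)) (2 * x + 1)) half-gap ⟩
  block (suc i + suc (i + g) ∸ (2 * suc k + 1)) (2 * suc k + 1)
    ≡⟨ cong₂ block ones-count (odd-part k) ⟩
  block (r + (i + i)) (suc (suc (suc (k + k))))
    ∎
  where
  g = r + suc (k + k)
  g>0 : 0 < g
  g>0 = ≤-trans (s≤s z≤n) (m≤n+m (suc (k + k)) r)
  shift : ∀ r k → suc (r + suc (k + k)) ≡ r + (suc k + suc k)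
  shift = solve-∀
  half-gap : ⌈ i + g ∸ i /2⌉ ≡ suc k
  half-gap = begin
    ⌊ suc (i + g ∸ i) /2⌋        ≡⟨ cong (λ x → ⌊ suc x /2⌋) (m+n∸m≡n i g) ⟩
    ⌊ suc (r + suc (k + k)) /2⌋  ≡⟨ cong ⌊_/2⌋ (shift r k) ⟩
    ⌊ r + (suc k + suc k) /2⌋    ≡⟨ ⌊r+[n+n]/2⌋≡n (suc k) r≤1 ⟩
    suc k                        ∎
  total : ∀ r i k → suc i + suc (i + (r + suc (k + k))) ≡ r + (i + i) + (2 * suc k + 1)
  total = solve-∀
  ones-count : suc i + suc (i + g) ∸ (2 * suc k + 1) ≡ r + (i + i)
  ones-count = trans (cong (_∸ (2 * suc k + 1)) (total r i k)) (m+n∸n≡m (r + (i + i)) (2 * suc k + 1))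
  odd-part : ∀ k → 2 * suc k + 1 ≡ suc (suc (suc (k + k)))
  odd-part = solve-∀

encodes-positive : ∀ {a b m q} → Encodes a b m q → 0 < a × 0 < b
encodes-positive (descent m b)    = ≤-trans (s≤s z≤n) (m≤n+m (suc b) m) , s≤s z≤n
encodes-positive (ascent _ _ _ _) = s≤s z≤n , s≤s z≤n

encodes-sum : ∀ {a b m q} → Encodes a b m q → m + suc (suc q) ≡ a + b
encodes-sum (descent m b) = total m b
  where
  total : ∀ m b → m + suc (suc (b + b)) ≡ m + suc b + suc b
  total = solve-∀
encodes-sum (ascent i r k _) = total r i k
  where
  total : ∀ r i k → r + (i + i) + suc (suc (suc (k + k))) ≡ suc i + (suc i + (r + suc (k + k)))
  total = solve-∀

ascentEncoding : ∀ i p → ∃₂ (Encodes (suc i) (suc i + suc p))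
ascentEncoding i p with parityView p
... | even j = _ , _ , ascent i 0 j z≤n
... | odd j  = _ , _ , ascent i 1 j (s≤s z≤n)

pairEncoding : ∀ {a b} → 0 < a → 0 < b → ∃₂ (Encodes a b)
pairEncoding {a} {suc b} _ _ with suc b ≤? a
... | yes b<a =
  _ , _ , subst (λ x → Encodes x (suc b) (a ∸ suc b) (b + b)) (m∸n+n≡m b<a) (descent (a ∸ suc b) b)
pairEncoding {suc i} {suc b} _ _ | no b≮a =
  subst (λ x → ∃₂ (Encodes (suc i) x)) (cong suc gap) (ascentEncoding i (b ∸ suc i))
  where
  gap : i + suc (b ∸ suc i) ≡ b
  gap = trans (+-suc i (b ∸ suc i)) (m+[n∸m]≡n (≤-pred (≰⇒> b≮a)))

blockEncoding : ∀ m q → ∃₂ λ a b → Encodes a b m q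
blockEncoding m q with parityView q | parityView m
... | even b | _      = _ , _ , descent m b
... | odd k  | even i = _ , _ , ascent i 0 k z≤n
... | odd k  | odd i  = _ , _ , ascent i 1 k (s≤s z≤n)

unpairBy : Parity → ℕ → ℕ → List ℕ
unpairBy 0ℙ m q = m + suc ⌊ q /2⌋ ∷ suc ⌊ q /2⌋ ∷ []
unpairBy 1ℙ m q = suc ⌊ m /2⌋ ∷ ⌈ m /2⌉ + suc q ∷ []

unpair : ℕ → ℕ → List ℕ
unpair m q = unpairBy (parity q) m q

encodes-unpair : ∀ {a b m q} → Encodes a b m q → unpair m q ≡ a ∷ b ∷ []
encodes-unpair (descent m b) rewrite parity[n+n]≡0ℙ b | sym (n≡⌊n+n/2⌋ b) = refl
encodes-unpair (ascent i r k r≤1)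
  rewrite parity[1+n+n]≡1ℙ k | ⌊r+[n+n]/2⌋≡n i r≤1 | ⌈r+[n+n]/2⌉≡r+n i r≤1 =
  cong (λ b → suc i ∷ b ∷ []) (regroup r i k)
  where
  regroup : ∀ r i k → r + i + suc (suc (k + k)) ≡ suc i + (r + suc (k + k))
  regroup = solve-∀

sum-pairBlock : ∀ {a b} → 0 < a → 0 < b → sum (pairBlock a b) ≡ a + b
sum-pairBlock {a} {b} a>0 b>0 with pairEncoding a>0 b>0
... | m , q , e = begin
  sum (pairBlock a b)          ≡⟨ cong sum (encodes-pairBlock e) ⟩
  sum (block m (suc (suc q)))  ≡⟨ sum-block m (suc (suc q)) ⟩
  m + suc (suc q)              ≡⟨ encodes-sum e ⟩
  a + b                        ∎

V-positive : ∀ c → Positive (V c)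
V-positive []          = []
V-positive (a ∷ [])    = ones-positive a
V-positive (a ∷ b ∷ c) = ++⁺ (pairBlock-positive a b) (V-positive c)

sum-V : ∀ c → Positive c → sum (V c) ≡ sum c
sum-V []          _                 = refl
sum-V (a ∷ [])    _                 = trans (sum-ones a) (sym (+-identityʳ a))
sum-V (a ∷ b ∷ c) (a>0 ∷ b>0 ∷ c>0) = begin
  sum (pairBlock a b ++ V c)       ≡⟨ sum-++ (pairBlock a b) (V c) ⟩
  sum (pairBlock a b) + sum (V c)  ≡⟨ cong₂ _+_ (sum-pairBlock a>0 b>0) (sum-V c c>0) ⟩
  a + b + sum c                    ≡⟨ +-assoc a b (sum c) ⟩
  a + (b + sum c)                  ∎

-- unV m d is the preimage of 1^m ++ d: the pending run of m ones is closed either by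
-- a part ≥ 2, through unpair, or by the end of the list, where it is an odd last part.
-- Parts 0 never occur in a composition and are skipped.
unV : ℕ → List ℕ → List ℕ
unV m       (zero ∷ d)        = unV m d
unV m       (suc zero ∷ d)    = unV (suc m) d
unV m       (suc (suc q) ∷ d) = unpair m q ++ unV 0 d
unV zero    []                = []
unV (suc m) []                = suc m ∷ []

unV-ones : ∀ m k d → unV m (ones k ++ d) ≡ unV (m + k) d
unV-ones m zero    d = cong (λ x → unV x d) (sym (+-identityʳ m))
unV-ones m (suc k) d = trans (unV-ones (suc m) k d) (cong (λ x → unV x d) (sym (+-suc m k)))

unV-positive : ∀ m d → Positive (unV m d)
unV-positive m       (zero ∷ d)        = unV-positive m d
unV-positive m       (suc zero ∷ d)    = unV-positive (suc m) d
unV-positive m       (suc (suc q) ∷ d) with blockEncoding m q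
... | a , b , e with encodes-positive e
...   | a>0 , b>0 =
  subst (λ x → Positive (x ++ unV 0 d)) (sym (encodes-unpair e)) (a>0 ∷ b>0 ∷ unV-positive 0 d)
unV-positive zero    []                = []
unV-positive (suc m) []                = s≤s z≤n ∷ []

unV-V : ∀ c → Positive c → unV 0 (V c) ≡ c
unV-V []           _ = refl
unV-V (suc a ∷ []) _ = begin
  unV 0 (ones (suc a))        ≡⟨ cong (unV 0) (sym (++-identityʳ (ones (suc a)))) ⟩
  unV 0 (ones (suc a) ++ [])  ≡⟨ unV-ones 0 (suc a) [] ⟩
  suc a ∷ []                  ∎
unV-V (a ∷ b ∷ c) (a>0 ∷ b>0 ∷ c>0) with pairEncoding a>0 b>0
... | m , q , e = begin
  unV 0 (pairBlock a b ++ V c)          ≡⟨ cong (λ x → unV 0 (x ++ V c)) (encodes-pairBlock e) ⟩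
  unV 0 (block m (suc (suc q)) ++ V c)  ≡⟨ cong (unV 0) (++-assoc (ones m) (suc (suc q) ∷ []) (V c)) ⟩
  unV 0 (ones m ++ suc (suc q) ∷ V c)   ≡⟨ unV-ones 0 m (suc (suc q) ∷ V c) ⟩
  unpair m q ++ unV 0 (V c)             ≡⟨ cong₂ _++_ (encodes-unpair e) (unV-V c c>0) ⟩
  a ∷ b ∷ c                             ∎

V-unV : ∀ m d → Positive d → V (unV m d) ≡ ones m ++ d
V-unV m       (suc zero ∷ d)    (_ ∷ d>0) = trans (V-unV (suc m) d d>0) (ones-suc m d)
V-unV m       (suc (suc q) ∷ d) (_ ∷ d>0) with blockEncoding m q
... | a , b , e = begin
  V (unpair m q ++ unV 0 d)     ≡⟨ cong (λ x → V (x ++ unV 0 d)) (encodes-unpair e) ⟩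
  pairBlock a b ++ V (unV 0 d)  ≡⟨ cong₂ _++_ (encodes-pairBlock e) (V-unV 0 d d>0) ⟩
  block m (suc (suc q)) ++ d    ≡⟨ ++-assoc (ones m) (suc (suc q) ∷ []) d ⟩
  ones m ++ suc (suc q) ∷ d     ∎
V-unV zero    []                _         = refl
V-unV (suc m) []                _         = sym (++-identityʳ (ones (suc m)))

theorem3p4 : (n : ℕ) → 1 ≤ n →
    ((c : List ℕ) → IsComposition n c → IsComposition n (V c))
    × ((c d : List ℕ) → IsComposition n c → IsComposition n d → V c ≡ V d → c ≡ d)
    × ((d : List ℕ) → IsComposition n d → Σ (List ℕ) (λ c → IsComposition n c × V c ≡ d))
theorem3p4 n _ = V-into , V-injective , V-surjective
  where
  V-into : ∀ c → IsComposition n c → IsComposition n (V c)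
  V-into c (c>0 , Σc≡n) = V-positive c , trans (sum-V c c>0) Σc≡n

  V-injective : ∀ c d → IsComposition n c → IsComposition n d → V c ≡ V d → c ≡ d
  V-injective c d (c>0 , _) (d>0 , _) Vc≡Vd = begin
    c            ≡⟨ sym (unV-V c c>0) ⟩
    unV 0 (V c)  ≡⟨ cong (unV 0) Vc≡Vd ⟩
    unV 0 (V d)  ≡⟨ unV-V d d>0 ⟩
    d            ∎

  V-surjective : ∀ d → IsComposition n d → Σ (List ℕ) λ c → IsComposition n c × V c ≡ d
  V-surjective d (d>0 , Σd≡n) = unV 0 d , (unV-positive 0 d , Σc≡n) , V-unV 0 d d>0
    where
    Σc≡n : sum (unV 0 d) ≡ n
    Σc≡n = begin
      sum (unV 0 d)      ≡⟨ sym (sum-V (unV 0 d) (unV-positive 0 d)) ⟩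
      sum (V (unV 0 d))  ≡⟨ cong sum (V-unV 0 d d>0) ⟩
      sum d              ≡⟨ Σd≡n ⟩
      n                  ∎
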